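{- For every finite graph $\Gamma$ there is a finite group $G$ such that $\Gamma$ is isomorphic to an induced subgraph of the conjugacy superenhanced power graph of $G$, and there is a finite group $G$ such that $\Gamma$ is isomorphic to an induced subgraph of the conjugacy supercommuting graph of $G$.
   Context: For a finite group $G$: the enhanced power graph has vertex set $G$, with distinct $g,h$ adjacent iff $\langle g,h\rangle$ is cyclic; the commuting graph: distinct $g,h$ adjacent iff $gh=hg$. For such a graph $\mathrm{A}$, the conjugacy super$\mathrm{A}$ graph has vertex set $G$, with distinct $g,h$ adjacent iff there exist a conjugate $g'$ of $g$ and a conjugate $h'$ of $h$ that are equal or adjacent in $\mathrm{A}$. -}

module Defs where

open import Data.Nat using (ℕ)
open import Data.Fin using (Fin)
open import Data.Bool using (Bool; true; false)
open import Data.Product using (Σ; ∃; ∃-syntax; _×_; _,_)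
open import Data.Sum using (_⊎_)
open import Relation.Nullary using (¬_)
open import Relation.Binary.PropositionalEquality using (_≡_; _≢_)
open import Function.Bundles using (_⇔_)
open import Function.Definitions using (Injective)
open import Algebra.Structures using (IsGroup)

record FiniteGroup : Set where
  field
    order   : ℕ
    _∙_     : Fin order → Fin order → Fin order
    ε       : Fin order
    _⁻¹     : Fin order → Fin order
    isGroup : IsGroup _≡_ _∙_ ε _⁻¹

record FiniteGraph : Set where
  field
    vertices  : ℕ
    adj       : Fin vertices → Fin vertices → Bool
    adj-sym   : ∀ u v → adj u v ≡ adj v u
    adj-irrfl : ∀ v → adj v v ≡ false

module _ (G : FiniteGroup) where
  open FiniteGroup G

  Elt : Set
  Elt = Fin order

  data InGen (S : Elt → Set) : Elt → Set where
    gen : ∀ {x} → S x → InGen S x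
    one : InGen S ε
    mul : ∀ {x y} → InGen S x → InGen S y → InGen S (x ∙ y)
    inv : ∀ {x} → InGen S x → InGen S (x ⁻¹)

  Pair : Elt → Elt → Elt → Set
  Pair g h x = (x ≡ g) ⊎ (x ≡ h)

  Single : Elt → Elt → Set
  Single z x = x ≡ z

  IsCyclicGen : (Elt → Set) → Set
  IsCyclicGen S = ∃[ z ] (InGen S z × (∀ x → InGen S x ⇔ InGen (Single z) x))

  EnhPowAdj : Elt → Elt → Set
  EnhPowAdj g h = g ≢ h × IsCyclicGen (Pair g h)

  CommAdj : Elt → Elt → Set
  CommAdj g h = g ≢ h × (g ∙ h ≡ h ∙ g)

  Conj : Elt → Elt → Set
  Conj g g' = ∃[ x ] (g' ≡ ((x ⁻¹) ∙ g) ∙ x)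

  SuperAdj : (Elt → Elt → Set) → Elt → Elt → Set
  SuperAdj A g h = g ≢ h ×
    (∃[ g' ] ∃[ h' ] (Conj g g' × Conj h h' × ((g' ≡ h') ⊎ A g' h')))

  SuperEnhPowAdj : Elt → Elt → Set
  SuperEnhPowAdj = SuperAdj EnhPowAdj

  SuperCommAdj : Elt → Elt → Set
  SuperCommAdj = SuperAdj CommAdj

IsoToInducedSubgraph : (Γ : FiniteGraph) (G : FiniteGroup) →
  (Fin (FiniteGroup.order G) → Fin (FiniteGroup.order G) → Set) → Set
IsoToInducedSubgraph Γ G R =
  ∃[ f ] (Injective _≡_ _≡_ f ×
    (∀ u v → (FiniteGraph.adj Γ u v ≡ true) ⇔ R (f u) (f v)))

-- Let s₀, s₁, … = 2, 3, 7, 43, … be Sylvester's sequence, so that s_u divides s_v − 1 whenever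
-- u < v, and put P = s_n − 1 for a graph on n vertices; then ℤ/P has an element ζ_u ≠ 0 of
-- order dividing s_u for every vertex u.  In the wreath product W = ℤ/P ≀ ℤ/P no conjugate of a
-- nontrivial rotation equals or commutes with a conjugate of a nontrivial "pulse" (a base vector
-- supported at one point).  Vertex u is sent to the element φ u of W^(n×n) whose (i, j) entry,
-- for every non-edge {i, j} (including i = j), is the rotation by ζ_u if u = i, the pulse ζ_u if
-- u = j, and trivial otherwise.  Adjacent u, v have disjoint supports, so φ u and φ v commute,
-- and for u < v we get (φ u φ v)^{s_v} = φ u; hence ⟨φ u, φ v⟩ = ⟨φ u φ v⟩ is cyclic.  For a
-- non-edge the (u, v) entries are a rotation and a pulse, and conjugation acts entrywise.

module Submission where

open import Defs
open import Level using (0ℓ)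
open import Data.Bool using (Bool; true; false)
open import Data.Empty using (⊥-elim)
open import Data.Nat as ℕ using (ℕ; zero; suc; NonZero; _+_; _∸_; _%_; _/_; _<_; s≤s)
open import Data.Nat.Properties as ℕ using ()
open import Data.Nat.DivMod using (_mod_; %-distribˡ-+; m<n⇒m%n≡m; n%n≡0; m%n%n≡m%n; m/n*n≡m)
open import Data.Nat.Divisibility using (_∣_; divides; ∣-trans; m∣m*n; n∣m*n)
open import Data.Fin using (Fin; toℕ)
open import Data.Fin.Properties using (_≟_; toℕ-injective; toℕ-fromℕ<; toℕ<n; *↔×)
open import Data.Vec using (Vec; []; _∷_; lookup; zipWith; replicate; map; tabulate)
open import Data.Vec.Properties
  using (lookup-zipWith; lookup∘tabulate; tabulate∘lookup; tabulate-cong; zipWith-comm;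
         zipWith-assoc; zipWith-identityˡ; zipWith-identityʳ; zipWith-inverseˡ; zipWith-inverseʳ)
open import Data.Product using (_×_; _,_; proj₁; proj₂; ∃-syntax)
open import Data.Product.Properties using (,-injectiveˡ)
open import Data.Product.Function.NonDependent.Propositional using (_×-↔_)
open import Data.Sum using (_⊎_; inj₁; inj₂)
open import Function.Base using (_∘_)
open import Function.Bundles using (_↔_; _⇔_; mk⇔; mk↔ₛ′; module Inverse; Equivalence)
open import Function.Properties.Inverse using (↔-refl; ↔-sym; ↔-trans)
open import Algebra.Bundles using (Group)
open import Algebra.Structures using (IsGroup)
open import Algebra.Definitions using (Associative; Identity; Inverse; Commutative)
open import Relation.Nullary using (¬_; Dec; yes; no; contradiction)
open import Relation.Nullary.Decidable using (decidable-stable)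
open import Relation.Binary.Definitions using (Tri; tri<; tri≈; tri>)
open import Relation.Binary.PropositionalEquality
open ≡-Reasoning

record Group≡ (A : Set) : Set where
  infixl 7 _∙_
  infix 8 _⁻¹
  infixr 8 _^_
  field
    _∙_      : A → A → A
    ε        : A
    _⁻¹      : A → A
    assoc    : Associative _≡_ _∙_
    identity : Identity _≡_ ε _∙_
    inverse  : Inverse _≡_ ε _⁻¹ _∙_

  isGroup : IsGroup _≡_ _∙_ ε _⁻¹
  isGroup = record
    { isMonoid = record
      { isSemigroup = record
        { isMagma = record { isEquivalence = isEquivalence ; ∙-cong = cong₂ _∙_ }
        ; assoc = assoc }
      ; identity = identity }
    ; inverse = inverse
    ; ⁻¹-cong = cong _⁻¹ }

  group : Group 0ℓ 0ℓ
  group = record { isGroup = isGroup }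

  open IsGroup isGroup public using (identityˡ; identityʳ; inverseˡ; inverseʳ)
  open import Algebra.Properties.Group group public
  open import Algebra.Properties.Monoid.Mult (Group.monoid group)
    using (×-assocˡ) renaming (_×_ to _·ℕ_)

  Commute : A → A → Set
  Commute x y = x ∙ y ≡ y ∙ x

  ε-commute : ∀ c → Commute ε c
  ε-commute c = trans (identityˡ c) (sym (identityʳ c))

  ∙-commute : ∀ {x y} c → Commute x c → Commute y c → Commute (x ∙ y) c
  ∙-commute {x} {y} c xc yc = begin
    x ∙ y ∙ c   ≡⟨ assoc x y c ⟩
    x ∙ (y ∙ c) ≡⟨ cong (x ∙_) yc ⟩
    x ∙ (c ∙ y) ≡⟨ assoc x c y ⟨
    x ∙ c ∙ y   ≡⟨ cong (_∙ y) xc ⟩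
    c ∙ x ∙ y   ≡⟨ assoc c x y ⟩
    c ∙ (x ∙ y) ∎

  ⁻¹-commute : ∀ {x} c → Commute x c → Commute (x ⁻¹) c
  ⁻¹-commute {x} c xc = begin
    x ⁻¹ ∙ c                ≡⟨ identityʳ _ ⟨
    x ⁻¹ ∙ c ∙ ε            ≡⟨ cong (x ⁻¹ ∙ c ∙_) (inverseʳ x) ⟨
    x ⁻¹ ∙ c ∙ (x ∙ x ⁻¹)   ≡⟨ assoc _ x _ ⟨
    x ⁻¹ ∙ c ∙ x ∙ x ⁻¹     ≡⟨ cong (_∙ x ⁻¹) (trans (assoc _ c x) (cong (x ⁻¹ ∙_) (sym xc))) ⟩
    x ⁻¹ ∙ (x ∙ c) ∙ x ⁻¹   ≡⟨ cong (_∙ x ⁻¹) (assoc _ x c) ⟨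
    x ⁻¹ ∙ x ∙ c ∙ x ⁻¹     ≡⟨ cong (λ y → y ∙ c ∙ x ⁻¹) (inverseˡ x) ⟩
    ε ∙ c ∙ x ⁻¹            ≡⟨ cong (_∙ x ⁻¹) (identityˡ c) ⟩
    c ∙ x ⁻¹                ∎

  _^_ : A → ℕ → A
  x ^ n = n ·ℕ x

  ^-assoc : ∀ x m n → (x ^ n) ^ m ≡ x ^ (m ℕ.* n)
  ^-assoc = ×-assocˡ

  ε^ : ∀ k → ε ^ k ≡ ε
  ε^ zero    = refl
  ε^ (suc k) = trans (identityˡ _) (ε^ k)

  x^k≡ε∧k∣n⇒x^[1+n]≡x : ∀ x {k n} → x ^ k ≡ ε → k ∣ n → x ^ suc n ≡ x
  x^k≡ε∧k∣n⇒x^[1+n]≡x x {k} x^k≡ε (divides q refl) = begin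
    x ∙ x ^ (q ℕ.* k) ≡⟨ cong (x ∙_) (^-assoc x q k) ⟨
    x ∙ (x ^ k) ^ q   ≡⟨ cong (λ y → x ∙ y ^ q) x^k≡ε ⟩
    x ∙ ε ^ q         ≡⟨ cong (x ∙_) (ε^ q) ⟩
    x ∙ ε             ≡⟨ identityʳ x ⟩
    x                 ∎

  ^-commute : ∀ x y → Commute x y → ∀ k → Commute y (x ^ k)
  ^-commute x y xy≡yx zero    = sym (ε-commute y)
  ^-commute x y xy≡yx (suc k) = begin
    y ∙ (x ∙ x ^ k) ≡⟨ assoc y x _ ⟨
    y ∙ x ∙ x ^ k   ≡⟨ cong (_∙ x ^ k) xy≡yx ⟨
    x ∙ y ∙ x ^ k   ≡⟨ assoc x y _ ⟩
    x ∙ (y ∙ x ^ k) ≡⟨ cong (x ∙_) (^-commute x y xy≡yx k) ⟩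
    x ∙ (x ^ k ∙ y) ≡⟨ assoc x _ y ⟨
    x ∙ x ^ k ∙ y   ∎

  ^-distrib-∙ : ∀ x y → Commute x y → ∀ k → (x ∙ y) ^ k ≡ x ^ k ∙ y ^ k
  ^-distrib-∙ x y xy≡yx zero    = sym (identityˡ ε)
  ^-distrib-∙ x y xy≡yx (suc k) = begin
    x ∙ y ∙ (x ∙ y) ^ k       ≡⟨ cong (x ∙ y ∙_) (^-distrib-∙ x y xy≡yx k) ⟩
    x ∙ y ∙ (x ^ k ∙ y ^ k)   ≡⟨ assoc x y _ ⟩
    x ∙ (y ∙ (x ^ k ∙ y ^ k)) ≡⟨ cong (x ∙_) (assoc y _ _) ⟨
    x ∙ (y ∙ x ^ k ∙ y ^ k)   ≡⟨ cong (λ z → x ∙ (z ∙ y ^ k)) (^-commute x y xy≡yx k) ⟩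
    x ∙ (x ^ k ∙ y ∙ y ^ k)   ≡⟨ cong (x ∙_) (assoc _ y _) ⟩
    x ∙ (x ^ k ∙ (y ∙ y ^ k)) ≡⟨ assoc x _ _ ⟨
    x ∙ x ^ k ∙ (y ∙ y ^ k)   ∎

  conj : A → A → A
  conj x g = (x ⁻¹ ∙ g) ∙ x

  conj-comm : ∀ x g → Commute x g → conj x g ≡ g
  conj-comm x g xg≡gx = begin
    x ⁻¹ ∙ g ∙ x   ≡⟨ assoc _ g x ⟩
    x ⁻¹ ∙ (g ∙ x) ≡⟨ cong (x ⁻¹ ∙_) xg≡gx ⟨
    x ⁻¹ ∙ (x ∙ g) ≡⟨ assoc _ x g ⟨
    x ⁻¹ ∙ x ∙ g   ≡⟨ cong (_∙ g) (inverseˡ x) ⟩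
    ε ∙ g          ≡⟨ identityˡ g ⟩
    g              ∎

  ConjugatesApart : A → A → Set
  ConjugatesApart g h = ∀ x y → let g′ = conj x g ; h′ = conj y h in
    g′ ≢ h′ × g′ ∙ h′ ≢ h′ ∙ g′

module _ {A B : Set} (G : Group≡ A) (H : Group≡ B) where
  private
    module G = Group≡ G
    module H = Group≡ H

  module Homomorphism (f : A → B) (f-∙ : ∀ x y → f (x G.∙ y) ≡ f x H.∙ f y) where

    f-ε : f G.ε ≡ H.ε
    f-ε = H.∙-cancelˡ (f G.ε) _ _ (begin
      f G.ε H.∙ f G.ε ≡⟨ f-∙ G.ε G.ε ⟨
      f (G.ε G.∙ G.ε) ≡⟨ cong f (G.identityˡ G.ε) ⟩
      f G.ε           ≡⟨ H.identityʳ (f G.ε) ⟨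
      f G.ε H.∙ H.ε   ∎)

    f-⁻¹ : ∀ x → f (x G.⁻¹) ≡ f x H.⁻¹
    f-⁻¹ x = H.inverseˡ-unique (f (x G.⁻¹)) (f x) (begin
      f (x G.⁻¹) H.∙ f x ≡⟨ f-∙ (x G.⁻¹) x ⟨
      f (x G.⁻¹ G.∙ x)   ≡⟨ cong f (G.inverseˡ x) ⟩
      f G.ε              ≡⟨ f-ε ⟩
      H.ε                ∎)

    f-^ : ∀ x k → f (x G.^ k) ≡ f x H.^ k
    f-^ x zero    = f-ε
    f-^ x (suc k) = trans (f-∙ x (x G.^ k)) (cong (f x H.∙_) (f-^ x k))

    f-^≡ε : ∀ x k → x G.^ k ≡ G.ε → f x H.^ k ≡ H.ε
    f-^≡ε x k x^k≡ε = trans (sym (f-^ x k)) (trans (cong f x^k≡ε) f-ε)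

    f-conj : ∀ x g → f (G.conj x g) ≡ H.conj (f x) (f g)
    f-conj x g = begin
      f (x G.⁻¹ G.∙ g G.∙ x)          ≡⟨ f-∙ _ x ⟩
      f (x G.⁻¹ G.∙ g) H.∙ f x        ≡⟨ cong (H._∙ f x) (f-∙ _ g) ⟩
      f (x G.⁻¹) H.∙ f g H.∙ f x      ≡⟨ cong (λ y → y H.∙ f g H.∙ f x) (f-⁻¹ x) ⟩
      f x H.⁻¹ H.∙ f g H.∙ f x        ∎

lookup-ext : ∀ {A : Set} {k} {xs ys : Vec A k} → (∀ i → lookup xs i ≡ lookup ys i) → xs ≡ ys
lookup-ext {xs = xs} {ys} eq = begin
  xs                   ≡⟨ tabulate∘lookup xs ⟨
  tabulate (lookup xs) ≡⟨ tabulate-cong eq ⟩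
  tabulate (lookup ys) ≡⟨ tabulate∘lookup ys ⟩
  ys                   ∎

Vec-group : ∀ {A} → Group≡ A → (k : ℕ) → Group≡ (Vec A k)
Vec-group G k = record
  { _∙_      = zipWith _∙_
  ; ε        = replicate k ε
  ; _⁻¹      = map _⁻¹
  ; assoc    = zipWith-assoc assoc
  ; identity = zipWith-identityˡ identityˡ , zipWith-identityʳ identityʳ
  ; inverse  = zipWith-inverseˡ inverseˡ , zipWith-inverseʳ inverseʳ
  }
  where open Group≡ G

module _ {A} (G : Group≡ A) {k : ℕ} (i : Fin k) where
  open Homomorphism (Vec-group G k) G (λ xs → lookup xs i) (λ xs ys → lookup-zipWith _ i xs ys) public
    using () renaming (f-conj to lookup-conj)

module _ {A} (G : Group≡ A) {k : ℕ} where
  private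
    module G = Group≡ G
    module V = Group≡ (Vec-group G k)

  apart-lookup : ∀ {a b} i → G.ConjugatesApart (lookup a i) (lookup b i) → V.ConjugatesApart a b
  apart-lookup {a} {b} i apart x y = a′≢b′ , a′b′≢b′a′
    where
    a′ b′ : Vec A k
    a′ = V.conj x a
    b′ = V.conj y b
    a′≢b′ : a′ ≢ b′
    a′≢b′ eq = proj₁ (apart (lookup x i) (lookup y i))
      (trans (sym (lookup-conj G i x a)) (trans (cong (λ v → lookup v i) eq) (lookup-conj G i y b)))
    a′b′≢b′a′ : a′ V.∙ b′ ≢ b′ V.∙ a′
    a′b′≢b′a′ eq = proj₂ (apart (lookup x i) (lookup y i)) (begin
      G.conj (lookup x i) (lookup a i) G.∙ G.conj (lookup y i) (lookup b i)
        ≡⟨ cong₂ G._∙_ (lookup-conj G i x a) (lookup-conj G i y b) ⟨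
      lookup a′ i G.∙ lookup b′ i ≡⟨ lookup-zipWith _ i a′ b′ ⟨
      lookup (a′ V.∙ b′) i        ≡⟨ cong (λ v → lookup v i) eq ⟩
      lookup (b′ V.∙ a′) i        ≡⟨ lookup-zipWith _ i b′ a′ ⟩
      lookup b′ i G.∙ lookup a′ i ≡⟨ cong₂ G._∙_ (lookup-conj G i y b) (lookup-conj G i x a) ⟩
      G.conj (lookup y i) (lookup b i) G.∙ G.conj (lookup x i) (lookup a i) ∎)

module ℤMod (P : ℕ) .{{_ : NonZero P}} where

  fromℕ : ℕ → Fin P
  fromℕ m = m mod P

  toℕ-fromℕ : ∀ m → toℕ (fromℕ m) ≡ m % P
  toℕ-fromℕ m = toℕ-fromℕ< _

  fromℕ-toℕ : ∀ a → fromℕ (toℕ a) ≡ a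
  fromℕ-toℕ a = toℕ-injective (trans (toℕ-fromℕ _) (m<n⇒m%n≡m (toℕ<n a)))

  fromℕ-% : ∀ m → fromℕ (m % P) ≡ fromℕ m
  fromℕ-% m = toℕ-injective (trans (toℕ-fromℕ _) (trans (m%n%n≡m%n m P) (sym (toℕ-fromℕ m))))

  _⊕_ : Fin P → Fin P → Fin P
  a ⊕ b = fromℕ (toℕ a + toℕ b)

  fromℕ-+ : ∀ m n → fromℕ m ⊕ fromℕ n ≡ fromℕ (m + n)
  fromℕ-+ m n = begin
    fromℕ (toℕ (fromℕ m) + toℕ (fromℕ n)) ≡⟨ cong₂ (λ x y → fromℕ (x + y)) (toℕ-fromℕ m) (toℕ-fromℕ n) ⟩
    fromℕ (m % P + n % P)                 ≡⟨ fromℕ-% _ ⟨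
    fromℕ ((m % P + n % P) % P)           ≡⟨ cong fromℕ (%-distribˡ-+ m n P) ⟨
    fromℕ ((m + n) % P)                   ≡⟨ fromℕ-% _ ⟩
    fromℕ (m + n)                         ∎

  ⊖_ : Fin P → Fin P
  ⊖ a = fromℕ (P ∸ toℕ a)

  fromℕ-P : fromℕ P ≡ fromℕ 0
  fromℕ-P = trans (sym (fromℕ-% P)) (cong fromℕ (n%n≡0 P))

  ⊕-comm : Commutative _≡_ _⊕_
  ⊕-comm a b = cong fromℕ (ℕ.+-comm (toℕ a) (toℕ b))

  ℤ/P : Group≡ (Fin P)
  ℤ/P = record
    { _∙_      = _⊕_
    ; ε        = fromℕ 0
    ; _⁻¹      = ⊖_
    ; assoc    = assoc
    ; identity = identityˡ , λ a → trans (⊕-comm a _) (identityˡ a)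
    ; inverse  = inverseˡ , λ a → trans (⊕-comm a _) (inverseˡ a)
    }
    where
    assoc : ∀ a b c → (a ⊕ b) ⊕ c ≡ a ⊕ (b ⊕ c)
    assoc a b c = begin
      (a ⊕ b) ⊕ c                           ≡⟨ cong ((a ⊕ b) ⊕_) (fromℕ-toℕ c) ⟨
      fromℕ (toℕ a + toℕ b) ⊕ fromℕ (toℕ c) ≡⟨ fromℕ-+ _ _ ⟩
      fromℕ (toℕ a + toℕ b + toℕ c)         ≡⟨ cong fromℕ (ℕ.+-assoc (toℕ a) _ _) ⟩
      fromℕ (toℕ a + (toℕ b + toℕ c))       ≡⟨ fromℕ-+ _ _ ⟨
      fromℕ (toℕ a) ⊕ (b ⊕ c)               ≡⟨ cong (_⊕ (b ⊕ c)) (fromℕ-toℕ a) ⟩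
      a ⊕ (b ⊕ c)                           ∎

    identityˡ : ∀ a → fromℕ 0 ⊕ a ≡ a
    identityˡ a = trans (cong (fromℕ 0 ⊕_) (sym (fromℕ-toℕ a))) (trans (fromℕ-+ 0 _) (fromℕ-toℕ a))

    inverseˡ : ∀ a → (⊖ a) ⊕ a ≡ fromℕ 0
    inverseˡ a = begin
      (⊖ a) ⊕ a                    ≡⟨ cong ((⊖ a) ⊕_) (fromℕ-toℕ a) ⟨
      (⊖ a) ⊕ fromℕ (toℕ a)        ≡⟨ fromℕ-+ _ _ ⟩
      fromℕ (P ∸ toℕ a + toℕ a)    ≡⟨ cong fromℕ (ℕ.m∸n+n≡m (ℕ.<⇒≤ (toℕ<n a))) ⟩
      fromℕ P                      ≡⟨ fromℕ-P ⟩
      fromℕ 0                      ∎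

  open Group≡ ℤ/P using (_^_; ε)

  fromℕ-^ : ∀ m k → fromℕ m ^ k ≡ fromℕ (k ℕ.* m)
  fromℕ-^ m zero    = refl
  fromℕ-^ m (suc k) = trans (cong (fromℕ m ⊕_) (fromℕ-^ m k)) (fromℕ-+ m (k ℕ.* m))

  fromℕ-^-cofactor : ∀ {q d} → P ≡ q ℕ.* d → fromℕ q ^ d ≡ ε
  fromℕ-^-cofactor {q} {d} P≡qd = begin
    fromℕ q ^ d        ≡⟨ fromℕ-^ q d ⟩
    fromℕ (d ℕ.* q)    ≡⟨ cong fromℕ (trans (ℕ.*-comm d q) (sym P≡qd)) ⟩
    fromℕ P            ≡⟨ fromℕ-P ⟩
    ε                  ∎

  fromℕ≢ε : ∀ {m} → 0 ℕ.< m → m ℕ.< P → fromℕ m ≢ ε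
  fromℕ≢ε {m} 0<m m<P eq = ℕ.<⇒≢ 0<m (begin
    0                    ≡⟨ m<n⇒m%n≡m (ℕ.>-nonZero⁻¹ P) ⟨
    0 % P                ≡⟨ toℕ-fromℕ 0 ⟨
    toℕ ε                ≡⟨ cong toℕ eq ⟨
    toℕ (fromℕ m)        ≡⟨ toℕ-fromℕ m ⟩
    m % P                ≡⟨ m<n⇒m%n≡m m<P ⟩
    m                    ∎)

  fromℕ-cofactor≢ε : ∀ {q d} → P ≡ q ℕ.* d → 1 ℕ.< d → fromℕ q ≢ ε
  fromℕ-cofactor≢ε {q} {d} P≡qd 1<d = fromℕ≢ε 0<q q<P
    where
    0<q : 0 ℕ.< q
    0<q = ℕ.n≢0⇒n>0 λ { refl → ℕ.≢-nonZero⁻¹ P P≡qd }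
    q<P : q ℕ.< P
    q<P = subst (q ℕ.<_) (sym P≡qd) (ℕ.m<m*n q d {{ℕ.>-nonZero 0<q}} 1<d)

module Wreath {A : Set} (G : Group≡ A) (comm : Commutative _≡_ (Group≡._∙_ G)) (P : ℕ) .{{_ : NonZero P}} where
  open ℤMod P using (ℤ/P; ⊕-comm)
  private
    module G = Group≡ G
    module C = Group≡ ℤ/P
    module B = Group≡ (Vec-group G P)

  Base : Set
  Base = Vec A P

  B-comm : Commutative _≡_ B._∙_
  B-comm = zipWith-comm comm

  rot : Fin P → Base → Base
  rot s b = tabulate (λ k → lookup b (k C.∙ s C.⁻¹))

  lookup-rot : ∀ s b k → lookup (rot s b) k ≡ lookup b (k C.∙ s C.⁻¹)
  lookup-rot s b k = lookup∘tabulate _ k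

  rot-id : ∀ b → rot C.ε b ≡ b
  rot-id b = lookup-ext λ k → begin
    lookup (rot C.ε b) k      ≡⟨ lookup-rot C.ε b k ⟩
    lookup b (k C.∙ C.ε C.⁻¹) ≡⟨ cong (λ t → lookup b (k C.∙ t)) C.ε⁻¹≈ε ⟩
    lookup b (k C.∙ C.ε)      ≡⟨ cong (lookup b) (C.identityʳ k) ⟩
    lookup b k                ∎

  rot-rot : ∀ s t b → rot s (rot t b) ≡ rot (s C.∙ t) b
  rot-rot s t b = lookup-ext λ k → begin
    lookup (rot s (rot t b)) k            ≡⟨ lookup-rot s (rot t b) k ⟩
    lookup (rot t b) (k C.∙ s C.⁻¹)       ≡⟨ lookup-rot t b _ ⟩
    lookup b (k C.∙ s C.⁻¹ C.∙ t C.⁻¹)    ≡⟨ cong (lookup b) (C.assoc k _ _) ⟩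
    lookup b (k C.∙ (s C.⁻¹ C.∙ t C.⁻¹))  ≡⟨ cong (λ u → lookup b (k C.∙ u)) (⊕-comm (s C.⁻¹) (t C.⁻¹)) ⟩
    lookup b (k C.∙ (t C.⁻¹ C.∙ s C.⁻¹))  ≡⟨ cong (λ u → lookup b (k C.∙ u)) (C.⁻¹-anti-homo-∙ s t) ⟨
    lookup b (k C.∙ (s C.∙ t) C.⁻¹)       ≡⟨ lookup-rot (s C.∙ t) b k ⟨
    lookup (rot (s C.∙ t) b) k            ∎

  rot-∙ : ∀ s a b → rot s (a B.∙ b) ≡ rot s a B.∙ rot s b
  rot-∙ s a b = lookup-ext λ k → begin
    lookup (rot s (a B.∙ b)) k                          ≡⟨ lookup-rot s (a B.∙ b) k ⟩
    lookup (a B.∙ b) (k C.∙ s C.⁻¹)                     ≡⟨ lookup-zipWith _ _ a b ⟩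
    lookup a (k C.∙ s C.⁻¹) G.∙ lookup b (k C.∙ s C.⁻¹) ≡⟨ cong₂ G._∙_ (lookup-rot s a k) (lookup-rot s b k) ⟨
    lookup (rot s a) k G.∙ lookup (rot s b) k           ≡⟨ lookup-zipWith _ k (rot s a) (rot s b) ⟨
    lookup (rot s a B.∙ rot s b) k                      ∎

  rot-ε : ∀ s → rot s B.ε ≡ B.ε
  rot-ε s = B.∙-cancelˡ (rot s B.ε) _ _ (begin
    rot s B.ε B.∙ rot s B.ε   ≡⟨ rot-∙ s B.ε B.ε ⟨
    rot s (B.ε B.∙ B.ε)       ≡⟨ cong (rot s) (B.identityˡ B.ε) ⟩
    rot s B.ε                 ≡⟨ B.identityʳ _ ⟨
    rot s B.ε B.∙ B.ε         ∎)

  rot-injective : ∀ s {a b} → rot s a ≡ rot s b → a ≡ b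
  rot-injective s {a} {b} eq = begin
    a                           ≡⟨ unrot a ⟨
    rot (s C.⁻¹) (rot s a)      ≡⟨ cong (rot (s C.⁻¹)) eq ⟩
    rot (s C.⁻¹) (rot s b)      ≡⟨ unrot b ⟩
    b                           ∎
    where
    unrot : ∀ c → rot (s C.⁻¹) (rot s c) ≡ c
    unrot c = trans (rot-rot _ s c) (trans (cong (λ t → rot t c) (C.inverseˡ s)) (rot-id c))

  rot-comm : ∀ s t b → rot s (rot t b) ≡ rot t (rot s b)
  rot-comm s t b = trans (rot-rot s t b) (trans (cong (λ u → rot u b) (⊕-comm s t)) (sym (rot-rot t s b)))

  W : Set
  W = Base × Fin P

  infixl 7 _·_

  _·_ : W → W → W
  (a , s) · (b , t) = a B.∙ rot s b , s C.∙ t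

  _⁻¹ʷ : W → W
  (a , s) ⁻¹ʷ = rot (s C.⁻¹) (a B.⁻¹) , s C.⁻¹

  wreath : Group≡ W
  wreath = record
    { _∙_      = _·_
    ; ε        = B.ε , C.ε
    ; _⁻¹      = _⁻¹ʷ
    ; assoc    = assoc
    ; identity = identityˡ , identityʳ
    ; inverse  = inverseˡ , inverseʳ
    }
    where
    assoc : ∀ x y z → (x · y) · z ≡ x · (y · z)
    assoc (a , s) (b , t) (c , u) = cong₂ _,_ (begin
      a B.∙ rot s b B.∙ rot (s C.∙ t) c      ≡⟨ B.assoc a _ _ ⟩
      a B.∙ (rot s b B.∙ rot (s C.∙ t) c)    ≡⟨ cong (λ d → a B.∙ (rot s b B.∙ d)) (rot-rot s t c) ⟨
      a B.∙ (rot s b B.∙ rot s (rot t c))    ≡⟨ cong (a B.∙_) (rot-∙ s b (rot t c)) ⟨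
      a B.∙ rot s (b B.∙ rot t c)            ∎) (C.assoc s t u)

    identityˡ : ∀ x → (B.ε , C.ε) · x ≡ x
    identityˡ (b , t) = cong₂ _,_ (trans (B.identityˡ _) (rot-id b)) (C.identityˡ t)

    identityʳ : ∀ x → x · (B.ε , C.ε) ≡ x
    identityʳ (a , s) = cong₂ _,_ (trans (cong (a B.∙_) (rot-ε s)) (B.identityʳ a)) (C.identityʳ s)

    inverseˡ : ∀ x → x ⁻¹ʷ · x ≡ (B.ε , C.ε)
    inverseˡ (a , s) = cong₂ _,_ (begin
      rot (s C.⁻¹) (a B.⁻¹) B.∙ rot (s C.⁻¹) a  ≡⟨ rot-∙ (s C.⁻¹) (a B.⁻¹) a ⟨
      rot (s C.⁻¹) (a B.⁻¹ B.∙ a)               ≡⟨ cong (rot (s C.⁻¹)) (B.inverseˡ a) ⟩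
      rot (s C.⁻¹) B.ε                          ≡⟨ rot-ε (s C.⁻¹) ⟩
      B.ε                                       ∎) (C.inverseˡ s)

    inverseʳ : ∀ x → x · x ⁻¹ʷ ≡ (B.ε , C.ε)
    inverseʳ (a , s) = cong₂ _,_ (begin
      a B.∙ rot s (rot (s C.⁻¹) (a B.⁻¹))  ≡⟨ cong (a B.∙_) (rot-rot s (s C.⁻¹) (a B.⁻¹)) ⟩
      a B.∙ rot (s C.∙ s C.⁻¹) (a B.⁻¹)    ≡⟨ cong (λ t → a B.∙ rot t (a B.⁻¹)) (C.inverseʳ s) ⟩
      a B.∙ rot C.ε (a B.⁻¹)               ≡⟨ cong (a B.∙_) (rot-id _) ⟩
      a B.∙ a B.⁻¹                         ≡⟨ B.inverseʳ a ⟩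
      B.ε                                  ∎) (C.inverseʳ s)

  open Group≡ wreath using (Commute; conj; ConjugatesApart)

  module Shift = Homomorphism wreath ℤ/P proj₂ (λ _ _ → refl)

  conj-shift : ∀ g x → proj₂ (conj g x) ≡ proj₂ x
  conj-shift g x = trans (Shift.f-conj g x) (C.conj-comm (proj₂ g) (proj₂ x) (⊕-comm (proj₂ g) (proj₂ x)))

  base : Base → W
  base v = v , C.ε

  conj-base : ∀ g v → conj g (base v) ≡ base (rot (proj₂ g C.⁻¹) v)
  conj-base (c , t) v = cong₂ _,_ (begin
    rot (t C.⁻¹) (c B.⁻¹) B.∙ rot (t C.⁻¹) v B.∙ rot (t C.⁻¹ C.∙ C.ε) c
      ≡⟨ cong (λ u → rot (t C.⁻¹) (c B.⁻¹) B.∙ rot (t C.⁻¹) v B.∙ rot u c) (C.identityʳ _) ⟩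
    rot (t C.⁻¹) (c B.⁻¹) B.∙ rot (t C.⁻¹) v B.∙ rot (t C.⁻¹) c
      ≡⟨ cong (B._∙ rot (t C.⁻¹) c) (rot-∙ (t C.⁻¹) (c B.⁻¹) v) ⟨
    rot (t C.⁻¹) (c B.⁻¹ B.∙ v) B.∙ rot (t C.⁻¹) c
      ≡⟨ rot-∙ (t C.⁻¹) (c B.⁻¹ B.∙ v) c ⟨
    rot (t C.⁻¹) (B.conj c v)
      ≡⟨ cong (rot (t C.⁻¹)) (B.conj-comm c v (B-comm c v)) ⟩
    rot (t C.⁻¹) v ∎) (conj-shift (c , t) (base v))

  commute-base⇒rot-fixed : ∀ g w → Commute g (base w) → rot (proj₂ g) w ≡ w
  commute-base⇒rot-fixed (d , s) w eq = B.∙-cancelˡ d _ _ (begin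
    d B.∙ rot s w      ≡⟨ ,-injectiveˡ eq ⟩
    w B.∙ rot C.ε d    ≡⟨ cong (w B.∙_) (rot-id d) ⟩
    w B.∙ d            ≡⟨ B-comm w d ⟩
    d B.∙ w            ∎)

  rot-fixed-under-rot : ∀ s r v → rot s (rot r v) ≡ rot r v → rot s v ≡ v
  rot-fixed-under-rot s r v eq = rot-injective r (trans (rot-comm r s v) eq)

  at-origin : A → Fin P → A
  at-origin α k with k ≟ C.ε
  ... | yes _ = α
  ... | no  _ = G.ε

  δ : A → Base
  δ α = tabulate (at-origin α)

  δ-∙ : ∀ α β → δ (α G.∙ β) ≡ δ α B.∙ δ β
  δ-∙ α β = lookup-ext λ k → begin
    lookup (δ (α G.∙ β)) k            ≡⟨ lookup∘tabulate _ k ⟩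
    at-origin (α G.∙ β) k             ≡⟨ at-origin-∙ k ⟩
    at-origin α k G.∙ at-origin β k   ≡⟨ cong₂ G._∙_ (lookup∘tabulate _ k) (lookup∘tabulate _ k) ⟨
    lookup (δ α) k G.∙ lookup (δ β) k ≡⟨ lookup-zipWith _ k (δ α) (δ β) ⟨
    lookup (δ α B.∙ δ β) k            ∎
    where
    at-origin-∙ : ∀ k → at-origin (α G.∙ β) k ≡ at-origin α k G.∙ at-origin β k
    at-origin-∙ k with k ≟ C.ε
    ... | yes _ = refl
    ... | no  _ = sym (G.identityˡ G.ε)

  rot-δ≢δ : ∀ {s α} → s ≢ C.ε → α ≢ G.ε → rot s (δ α) ≢ δ α
  rot-δ≢δ {s} {α} s≢ε α≢ε eq = α≢ε (begin
    α                           ≡⟨ at-origin-ε ⟨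
    at-origin α C.ε             ≡⟨ lookup∘tabulate _ C.ε ⟨
    lookup (δ α) C.ε            ≡⟨ cong (lookup (δ α)) (C.inverseʳ s) ⟨
    lookup (δ α) (s C.∙ s C.⁻¹) ≡⟨ lookup-rot s (δ α) s ⟨
    lookup (rot s (δ α)) s      ≡⟨ cong (λ v → lookup v s) eq ⟩
    lookup (δ α) s              ≡⟨ lookup∘tabulate _ s ⟩
    at-origin α s               ≡⟨ at-origin-off ⟩
    G.ε                         ∎)
    where
    at-origin-ε : at-origin α C.ε ≡ α
    at-origin-ε with C.ε ≟ C.ε
    ... | yes _   = refl
    ... | no  ε≢ε = contradiction refl ε≢ε
    at-origin-off : at-origin α s ≡ G.ε
    at-origin-off with s ≟ C.ε
    ... | yes s≡ε = contradiction s≡ε s≢ε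
    ... | no  _   = refl

  rotation : Fin P → W
  rotation s = B.ε , s

  pulse : A → W
  pulse α = base (δ α)

  module Rotation = Homomorphism ℤ/P wreath rotation
    (λ s t → cong (_, s C.∙ t) (sym (trans (cong (B.ε B.∙_) (rot-ε s)) (B.identityˡ B.ε))))

  module Pulse = Homomorphism G wreath pulse
    (λ α β → cong₂ _,_ (trans (δ-∙ α β) (cong (δ α B.∙_) (sym (rot-id (δ β)))))
                       (sym (C.identityˡ C.ε)))

  -- A conjugate of a rotation by s still rotates by s, a conjugate of a pulse is a pulse, and a
  -- rotation by s ≢ ε moves every pulse.
  rotation-pulse-apart : ∀ {s α} → s ≢ C.ε → α ≢ G.ε → ConjugatesApart (rotation s) (pulse α)
  rotation-pulse-apart {s} {α} s≢ε α≢ε x y = g′≢h′ , g′h′≢h′g′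
    where
    g′ : W
    g′ = conj x (rotation s)
    r : Fin P
    r = proj₂ y C.⁻¹
    h′≡base : conj y (pulse α) ≡ base (rot r (δ α))
    h′≡base = conj-base y (δ α)
    shift-g′ : proj₂ g′ ≡ s
    shift-g′ = conj-shift x (rotation s)

    g′≢h′ : g′ ≢ conj y (pulse α)
    g′≢h′ eq = s≢ε (trans (sym shift-g′) (trans (cong proj₂ eq) (conj-shift y (pulse α))))

    g′h′≢h′g′ : g′ · conj y (pulse α) ≢ conj y (pulse α) · g′
    g′h′≢h′g′ eq = rot-δ≢δ s≢ε α≢ε (rot-fixed-under-rot s r (δ α)
      (subst (λ t → rot t (rot r (δ α)) ≡ rot r (δ α)) shift-g′
        (commute-base⇒rot-fixed g′ (rot r (δ α)) (subst (Commute g′) h′≡base eq))))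

module Transport {A : Set} {N : ℕ} (G : Group≡ A) (e : A ↔ Fin N) where
  open Inverse e using (to; from; strictlyInverseˡ; strictlyInverseʳ)
  open Group≡ G

  transported : Group≡ (Fin N)
  transported = record
    { _∙_      = λ a b → to (from a ∙ from b)
    ; ε        = to ε
    ; _⁻¹      = λ a → to (from a ⁻¹)
    ; assoc    = λ a b c → cong to (begin
        from (to (from a ∙ from b)) ∙ from c ≡⟨ cong (_∙ from c) (strictlyInverseʳ _) ⟩
        from a ∙ from b ∙ from c             ≡⟨ assoc _ _ _ ⟩
        from a ∙ (from b ∙ from c)           ≡⟨ cong (from a ∙_) (strictlyInverseʳ _) ⟨
        from a ∙ from (to (from b ∙ from c)) ∎)
    ; identity = (λ a → trans (cong to (trans (cong (_∙ from a) (strictlyInverseʳ ε)) (identityˡ _))) (strictlyInverseˡ a))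
               , (λ a → trans (cong to (trans (cong (from a ∙_) (strictlyInverseʳ ε)) (identityʳ _))) (strictlyInverseˡ a))
    ; inverse  = (λ a → cong to (trans (cong (_∙ from a) (strictlyInverseʳ _)) (inverseˡ _)))
               , (λ a → cong to (trans (cong (from a ∙_) (strictlyInverseʳ _)) (inverseʳ _)))
    }

  private module T = Group≡ transported

  to-∙ : ∀ x y → to (x ∙ y) ≡ to x T.∙ to y
  to-∙ x y = cong to (sym (cong₂ _∙_ (strictlyInverseʳ x) (strictlyInverseʳ y)))

  module To = Homomorphism G transported to to-∙
  module From = Homomorphism transported G from (λ a b → strictlyInverseʳ _)

  apart-transport : ∀ {a b} → ConjugatesApart a b → T.ConjugatesApart (to a) (to b)
  apart-transport {a} {b} apart x y = g′≢h′ , g′h′≢h′g′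
    where
    g′ h′ : Fin N
    g′ = T.conj x (to a)
    h′ = T.conj y (to b)
    from-conj : ∀ z c → from (T.conj z (to c)) ≡ conj (from z) c
    from-conj z c = trans (From.f-conj z (to c)) (cong (conj (from z)) (strictlyInverseʳ c))
    g′≢h′ : g′ ≢ h′
    g′≢h′ eq = proj₁ (apart (from x) (from y))
      (trans (sym (from-conj x a)) (trans (cong from eq) (from-conj y b)))
    g′h′≢h′g′ : g′ T.∙ h′ ≢ h′ T.∙ g′
    g′h′≢h′g′ eq = proj₂ (apart (from x) (from y)) (begin
      conj (from x) a ∙ conj (from y) b ≡⟨ cong₂ _∙_ (from-conj x a) (from-conj y b) ⟨
      from g′ ∙ from h′                 ≡⟨ strictlyInverseʳ (from g′ ∙ from h′) ⟨
      from (g′ T.∙ h′)                  ≡⟨ cong from eq ⟩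
      from (h′ T.∙ g′)                  ≡⟨ strictlyInverseʳ (from h′ ∙ from g′) ⟩
      from h′ ∙ from g′                 ≡⟨ cong₂ _∙_ (from-conj y b) (from-conj x a) ⟩
      conj (from y) b ∙ conj (from x) a ∎)

finite : ∀ {N} → Group≡ (Fin N) → FiniteGroup
finite {N} G = record { order = N ; _∙_ = _∙_ ; ε = ε ; _⁻¹ = _⁻¹ ; isGroup = isGroup }
  where open Group≡ G

module _ {N} (G : Group≡ (Fin N)) where
  open Group≡ G
  private 𝔾 = finite G

  InGen-⊆ : ∀ {S T : Fin N → Set} → (∀ {x} → S x → InGen 𝔾 T x) → ∀ {x} → InGen 𝔾 S x → InGen 𝔾 T x
  InGen-⊆ S⊆T (gen s)   = S⊆T s
  InGen-⊆ S⊆T one       = one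
  InGen-⊆ S⊆T (mul p q) = mul (InGen-⊆ S⊆T p) (InGen-⊆ S⊆T q)
  InGen-⊆ S⊆T (inv p)   = inv (InGen-⊆ S⊆T p)

  InGen-commute : ∀ {S} c → (∀ {x} → S x → Commute x c) → ∀ {x} → InGen 𝔾 S x → Commute x c
  InGen-commute c S-comm (gen s)   = S-comm s
  InGen-commute c S-comm one       = ε-commute c
  InGen-commute c S-comm (mul p q) = ∙-commute c (InGen-commute c S-comm p) (InGen-commute c S-comm q)
  InGen-commute c S-comm (inv p)   = ⁻¹-commute c (InGen-commute c S-comm p)

  cyclic-commute : ∀ {z a b} → InGen 𝔾 (Single 𝔾 z) a → InGen 𝔾 (Single 𝔾 z) b → Commute a b
  cyclic-commute {z} {a} za zb = sym (InGen-commute a (λ { refl → sym a-comm-z }) zb)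
    where
    a-comm-z : Commute a z
    a-comm-z = InGen-commute z (λ { refl → refl }) za

  ^∈⟨⟩ : ∀ z k → InGen 𝔾 (Single 𝔾 z) (z ^ k)
  ^∈⟨⟩ z zero    = one
  ^∈⟨⟩ z (suc k) = mul (gen refl) (^∈⟨⟩ z k)

  product-generates-pair : ∀ {g h} → InGen 𝔾 (Single 𝔾 (g ∙ h)) g × InGen 𝔾 (Single 𝔾 (g ∙ h)) h →
    IsCyclicGen 𝔾 (Pair 𝔾 g h)
  product-generates-pair {g} {h} (g∈ , h∈) =
    g ∙ h , gh∈⟨g,h⟩ , λ x → mk⇔ (InGen-⊆ ⟨g,h⟩⊆) (InGen-⊆ λ { refl → gh∈⟨g,h⟩ })
    where
    gh∈⟨g,h⟩ : InGen 𝔾 (Pair 𝔾 g h) (g ∙ h)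
    gh∈⟨g,h⟩ = mul (gen (inj₁ refl)) (gen (inj₂ refl))
    ⟨g,h⟩⊆ : ∀ {x} → Pair 𝔾 g h x → InGen 𝔾 (Single 𝔾 (g ∙ h)) x
    ⟨g,h⟩⊆ (inj₁ refl) = g∈
    ⟨g,h⟩⊆ (inj₂ refl) = h∈

  conj-refl : ∀ g → Conj 𝔾 g g
  conj-refl g = ε , sym (conj-comm ε g (ε-commute g))

  power-of-product-generates : ∀ {g h} k → (g ∙ h) ^ k ≡ g ⊎ (g ∙ h) ^ k ≡ h →
    InGen 𝔾 (Single 𝔾 (g ∙ h)) g × InGen 𝔾 (Single 𝔾 (g ∙ h)) h
  power-of-product-generates {g} {h} k (inj₁ eq) =
    g∈ , subst (InGen 𝔾 (Single 𝔾 (g ∙ h))) (\\-leftDividesʳ g h) (mul (inv g∈) (gen refl))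
    where
    g∈ : InGen 𝔾 (Single 𝔾 (g ∙ h)) g
    g∈ = subst (InGen 𝔾 (Single 𝔾 (g ∙ h))) eq (^∈⟨⟩ (g ∙ h) k)
  power-of-product-generates {g} {h} k (inj₂ eq) =
    subst (InGen 𝔾 (Single 𝔾 (g ∙ h))) (//-rightDividesʳ h g) (mul (gen refl) (inv h∈)) , h∈
    where
    h∈ : InGen 𝔾 (Single 𝔾 (g ∙ h)) h
    h∈ = subst (InGen 𝔾 (Single 𝔾 (g ∙ h))) eq (^∈⟨⟩ (g ∙ h) k)

  power-of-product⇒superAdj : ∀ {g h} → g ≢ h → Commute g h →
    ∃[ k ] ((g ∙ h) ^ k ≡ g ⊎ (g ∙ h) ^ k ≡ h) → SuperEnhPowAdj 𝔾 g h × SuperCommAdj 𝔾 g h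
  power-of-product⇒superAdj {g} {h} g≢h gh≡hg (k , power≡factor) =
      (g≢h , g , h , conj-refl g , conj-refl h , inj₂ (g≢h , cyclic))
    , (g≢h , g , h , conj-refl g , conj-refl h , inj₂ (g≢h , gh≡hg))
    where
    cyclic : IsCyclicGen 𝔾 (Pair 𝔾 g h)
    cyclic = product-generates-pair (power-of-product-generates k power≡factor)

  apart⇒¬superAdj : ∀ {g h} → ConjugatesApart g h → ¬ SuperEnhPowAdj 𝔾 g h × ¬ SuperCommAdj 𝔾 g h
  apart⇒¬superAdj {g} {h} apart = ¬enh , ¬comm
    where
    ¬enh : ¬ SuperEnhPowAdj 𝔾 g h
    ¬enh (_ , _ , _ , (x , refl) , (y , refl) , inj₁ eq) = proj₁ (apart x y) eq
    ¬enh (_ , _ , _ , (x , refl) , (y , refl) , inj₂ (_ , z , _ , ⟨g′,h′⟩≃⟨z⟩)) =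
      proj₂ (apart x y) (cyclic-commute (Equivalence.to (⟨g′,h′⟩≃⟨z⟩ _) (gen (inj₁ refl)))
                                        (Equivalence.to (⟨g′,h′⟩≃⟨z⟩ _) (gen (inj₂ refl))))
    ¬comm : ¬ SuperCommAdj 𝔾 g h
    ¬comm (_ , _ , _ , (x , refl) , (y , refl) , inj₁ eq)        = proj₁ (apart x y) eq
    ¬comm (_ , _ , _ , (x , refl) , (y , refl) , inj₂ (_ , comm)) = proj₂ (apart x y) comm

Vec-∷↔× : ∀ {A : Set} {k} → Vec A (suc k) ↔ (A × Vec A k)
Vec-∷↔× = mk↔ₛ′ (λ { (x ∷ xs) → x , xs }) (λ (x , xs) → x ∷ xs) (λ _ → refl) (λ { (_ ∷ _) → refl })

Vec↔Fin : ∀ {A : Set} {a} → A ↔ Fin a → (k : ℕ) → Vec A k ↔ Fin (a ℕ.^ k)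
Vec↔Fin e zero    = mk↔ₛ′ (λ _ → Fin.zero) (λ _ → []) (λ { Fin.zero → refl ; (Fin.suc ()) }) (λ { [] → refl })
Vec↔Fin e (suc k) = ↔-trans Vec-∷↔× (↔-trans (e ×-↔ Vec↔Fin e k) (↔-sym *↔×))

pred-sylvester : ℕ → ℕ
pred-sylvester zero    = 1
pred-sylvester (suc k) = pred-sylvester k ℕ.* suc (pred-sylvester k)

sylvester : ℕ → ℕ
sylvester k = suc (pred-sylvester k)

pred-sylvester-nonZero : ∀ k → NonZero (pred-sylvester k)
pred-sylvester-nonZero zero    = _
pred-sylvester-nonZero (suc k) = ℕ.m*n≢0 (pred-sylvester k) (sylvester k) {{pred-sylvester-nonZero k}}

1<sylvester : ∀ k → 1 < sylvester k
1<sylvester k = s≤s (ℕ.>-nonZero⁻¹ (pred-sylvester k) {{pred-sylvester-nonZero k}})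

sylvester∣pred-sylvester : ∀ {u v} → u < v → sylvester u ∣ pred-sylvester v
sylvester∣pred-sylvester {u} {suc v} (s≤s u≤v) with ℕ.m≤n⇒m<n∨m≡n u≤v
... | inj₁ u<v  = ∣-trans (sylvester∣pred-sylvester u<v) (m∣m*n (sylvester v))
... | inj₂ refl = n∣m*n (pred-sylvester u)

module Construction (Γ : FiniteGraph) where
  open FiniteGraph Γ

  P : ℕ
  P = pred-sylvester vertices

  instance
    P-nonZero : NonZero P
    P-nonZero = pred-sylvester-nonZero vertices

  open ℤMod P using (ℤ/P; ⊕-comm; fromℕ; fromℕ-^-cofactor; fromℕ-cofactor≢ε)
  open Wreath ℤ/P ⊕-comm P
    using (W; wreath; rotation; pulse; rotation-pulse-apart; module Rotation; module Pulse)

  private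
    module C = Group≡ ℤ/P
    module H = Group≡ wreath
    module T = Group≡ (Vec-group (Vec-group wreath vertices) vertices)

  order : Fin vertices → ℕ
  order u = sylvester (toℕ u)

  ζ : Fin vertices → Fin P
  ζ u = fromℕ (P / order u)

  P≡cofactor*order : ∀ u → P ≡ P / order u ℕ.* order u
  P≡cofactor*order u = sym (m/n*n≡m (sylvester∣pred-sylvester (toℕ<n u)))

  ζ^order≡ε : ∀ u → ζ u C.^ order u ≡ C.ε
  ζ^order≡ε u = fromℕ-^-cofactor {P / order u} {order u} (P≡cofactor*order u)

  ζ≢ε : ∀ u → ζ u ≢ C.ε
  ζ≢ε u = fromℕ-cofactor≢ε {P / order u} {order u} (P≡cofactor*order u) (1<sylvester (toℕ u))

  -- The diagonal entry (u, u) is the rotation by ζ u (as adj u u ≡ false); it makes φ injective.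
  entry : Fin vertices → Fin vertices → Fin vertices → W
  entry u i j with adj i j | u ≟ i | u ≟ j
  ... | true  | _     | _     = H.ε
  ... | false | yes _ | _     = rotation (ζ u)
  ... | false | no _  | yes _ = pulse (ζ u)
  ... | false | no _  | no _  = H.ε

  entry-^-order : ∀ u i j → entry u i j H.^ order u ≡ H.ε
  entry-^-order u i j with adj i j | u ≟ i | u ≟ j
  ... | true  | _     | _     = H.ε^ (order u)
  ... | false | yes _ | _     = Rotation.f-^≡ε (ζ u) (order u) (ζ^order≡ε u)
  ... | false | no _  | yes _ = Pulse.f-^≡ε (ζ u) (order u) (ζ^order≡ε u)
  ... | false | no _  | no _  = H.ε^ (order u)

  entry-outside : ∀ {w i j} → w ≢ i → w ≢ j → entry w i j ≡ H.ε
  entry-outside {w} {i} {j} w≢i w≢j with adj i j | w ≟ i | w ≟ j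
  ... | true  | _       | _       = refl
  ... | false | yes w≡i | _       = contradiction w≡i w≢i
  ... | false | no _    | yes w≡j = contradiction w≡j w≢j
  ... | false | no _    | no _    = refl

  entry-on-edge : ∀ w {i j} → adj i j ≡ true → entry w i j ≡ H.ε
  entry-on-edge w {i} {j} ij with adj i j
  entry-on-edge w {i} {j} refl | true = refl

  entry-rotation : ∀ {u v} → adj u v ≡ false → entry u u v ≡ rotation (ζ u)
  entry-rotation {u} {v} uv with adj u v | u ≟ u
  ... | false | yes _   = refl
  ... | false | no u≢u  = contradiction refl u≢u
  entry-rotation {u} {v} () | true | _

  entry-pulse : ∀ {u v} → u ≢ v → adj u v ≡ false → entry v u v ≡ pulse (ζ v)
  entry-pulse {u} {v} u≢v uv with adj u v | v ≟ u | v ≟ v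
  ... | false | no _    | yes _  = refl
  ... | false | yes v≡u | _      = contradiction (sym v≡u) u≢v
  ... | false | no _    | no v≢v = contradiction refl v≢v
  entry-pulse {u} {v} u≢v () | true | _ | _

  entry-disjoint : ∀ {u v} → u ≢ v → adj u v ≡ true → ∀ i j → entry u i j ≡ H.ε ⊎ entry v i j ≡ H.ε
  entry-disjoint {u} {v} u≢v uv i j = by-cases (u ≟ i) (u ≟ j) (v ≟ i) (v ≟ j) u≢v uv
    where
    by-cases : ∀ {u v i j} → Dec (u ≡ i) → Dec (u ≡ j) → Dec (v ≡ i) → Dec (v ≡ j) →
      u ≢ v → adj u v ≡ true → entry u i j ≡ H.ε ⊎ entry v i j ≡ H.ε
    by-cases (no u≢i)   (no u≢j)   _          _          _   _  = inj₁ (entry-outside u≢i u≢j)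
    by-cases _          _          (no v≢i)   (no v≢j)   _   _  = inj₂ (entry-outside v≢i v≢j)
    by-cases (yes refl) _          (yes refl) _          u≢v _  = contradiction refl u≢v
    by-cases _          (yes refl) _          (yes refl) u≢v _  = contradiction refl u≢v
    by-cases {u} (yes refl) _      (no _)     (yes refl) _   uv = inj₁ (entry-on-edge u uv)
    by-cases {u} {v} (no _) (yes refl) (yes refl) _      _   uv = inj₁ (entry-on-edge u (trans (adj-sym v u) uv))

  φ : Fin vertices → Vec (Vec W vertices) vertices
  φ u = tabulate λ i → tabulate λ j → entry u i j

  entryOf : Vec (Vec W vertices) vertices → Fin vertices → Fin vertices → W
  entryOf x i j = lookup (lookup x i) j

  entryOf-φ : ∀ u i j → entryOf (φ u) i j ≡ entry u i j
  entryOf-φ u i j = trans (cong (λ r → lookup r j) (lookup∘tabulate _ i)) (lookup∘tabulate _ j)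

  entryOf-ext : ∀ {x y} → (∀ i j → entryOf x i j ≡ entryOf y i j) → x ≡ y
  entryOf-ext eq = lookup-ext λ i → lookup-ext λ j → eq i j

  entryOf-∙ : ∀ i j x y → entryOf (x T.∙ y) i j ≡ entryOf x i j H.∙ entryOf y i j
  entryOf-∙ i j x y = trans (cong (λ r → lookup r j) (lookup-zipWith _ i x y)) (lookup-zipWith _ j (lookup x i) (lookup y i))

  module Entry (i j : Fin vertices) =
    Homomorphism (Vec-group (Vec-group wreath vertices) vertices) wreath (λ x → entryOf x i j) (entryOf-∙ i j)

  φ-^-order : ∀ u → φ u T.^ order u ≡ T.ε
  φ-^-order u = entryOf-ext λ i j → begin
    entryOf (φ u T.^ order u) i j ≡⟨ Entry.f-^ i j (φ u) (order u) ⟩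
    entryOf (φ u) i j H.^ order u ≡⟨ cong (H._^ order u) (entryOf-φ u i j) ⟩
    entry u i j H.^ order u       ≡⟨ entry-^-order u i j ⟩
    H.ε                           ≡⟨ Entry.f-ε i j ⟨
    entryOf T.ε i j               ∎

  φ-commute : ∀ {u v} → u ≢ v → adj u v ≡ true → T.Commute (φ u) (φ v)
  φ-commute {u} {v} u≢v uv = entryOf-ext λ i j → begin
    entryOf (φ u T.∙ φ v) i j               ≡⟨ entryOf-∙ i j (φ u) (φ v) ⟩
    entryOf (φ u) i j H.∙ entryOf (φ v) i j ≡⟨ cong₂ H._∙_ (entryOf-φ u i j) (entryOf-φ v i j) ⟩
    entry u i j H.∙ entry v i j             ≡⟨ commute (entry-disjoint u≢v uv i j) ⟩
    entry v i j H.∙ entry u i j             ≡⟨ cong₂ H._∙_ (entryOf-φ v i j) (entryOf-φ u i j) ⟨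
    entryOf (φ v) i j H.∙ entryOf (φ u) i j ≡⟨ entryOf-∙ i j (φ v) (φ u) ⟨
    entryOf (φ v T.∙ φ u) i j               ∎
    where
    commute : ∀ {a b} → a ≡ H.ε ⊎ b ≡ H.ε → H.Commute a b
    commute {b = b} (inj₁ refl) = H.ε-commute b
    commute {a = a} (inj₂ refl) = sym (H.ε-commute a)

  φ-apart : ∀ {u v} → u ≢ v → adj u v ≡ false → T.ConjugatesApart (φ u) (φ v)
  φ-apart {u} {v} u≢v uv = apart-lookup (Vec-group wreath vertices) u (apart-lookup wreath v
    (subst₂ H.ConjugatesApart
      (trans (sym (entry-rotation uv)) (sym (entryOf-φ u u v)))
      (trans (sym (entry-pulse u≢v uv)) (sym (entryOf-φ v u v)))
      (rotation-pulse-apart (ζ≢ε u) (ζ≢ε v))))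

  φ-injective : ∀ {u v} → φ u ≡ φ v → u ≡ v
  φ-injective {u} {v} eq = decidable-stable (u ≟ v) λ u≢v → ζ≢ε u (cong proj₂ (begin
    rotation (ζ u)    ≡⟨ entry-rotation (adj-irrfl u) ⟨
    entry u u u       ≡⟨ entryOf-φ u u u ⟨
    entryOf (φ u) u u ≡⟨ cong (λ x → entryOf x u u) eq ⟩
    entryOf (φ v) u u ≡⟨ entryOf-φ v u u ⟩
    entry v u u       ≡⟨ entry-outside (u≢v ∘ sym) (u≢v ∘ sym) ⟩
    H.ε               ∎))

  φ-product-^ : ∀ {u v} → u ≢ v → adj u v ≡ true → toℕ u ℕ.< toℕ v →
    (φ u T.∙ φ v) T.^ order v ≡ φ u
  φ-product-^ {u} {v} u≢v uv u<v = begin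
    (φ u T.∙ φ v) T.^ order v
      ≡⟨ T.^-distrib-∙ _ _ (φ-commute u≢v uv) (order v) ⟩
    φ u T.^ order v T.∙ φ v T.^ order v
      ≡⟨ cong₂ T._∙_ (T.x^k≡ε∧k∣n⇒x^[1+n]≡x _ (φ-^-order u) (sylvester∣pred-sylvester u<v))
                     (φ-^-order v) ⟩
    φ u T.∙ T.ε
      ≡⟨ T.identityʳ _ ⟩
    φ u ∎

  N : ℕ
  N = (((P ℕ.^ P) ℕ.* P) ℕ.^ vertices) ℕ.^ vertices

  T↔Fin : Vec (Vec W vertices) vertices ↔ Fin N
  T↔Fin = Vec↔Fin (Vec↔Fin (↔-trans (Vec↔Fin ↔-refl P ×-↔ ↔-refl) (↔-sym *↔×)) vertices) vertices

  module Enc = Transport (Vec-group (Vec-group wreath vertices) vertices) T↔Fin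
  open Inverse T↔Fin using (to; from; strictlyInverseʳ)

  𝔾 : Group≡ (Fin N)
  𝔾 = Enc.transported

  private module 𝔾 = Group≡ 𝔾

  embed : Fin vertices → Fin N
  embed u = to (φ u)

  embed-injective : ∀ {u v} → embed u ≡ embed v → u ≡ v
  embed-injective eq = φ-injective
    (trans (sym (strictlyInverseʳ _)) (trans (cong from eq) (strictlyInverseʳ _)))

  adjacent⇒distinct : ∀ {u v} → adj u v ≡ true → u ≢ v
  adjacent⇒distinct {u} uv refl = contradiction (trans (sym uv) (adj-irrfl u)) λ ()

  embed-commute : ∀ {u v} → adj u v ≡ true → 𝔾.Commute (embed u) (embed v)
  embed-commute {u} {v} uv = begin
    embed u 𝔾.∙ embed v ≡⟨ Enc.to-∙ (φ u) (φ v) ⟨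
    to (φ u T.∙ φ v)    ≡⟨ cong to (φ-commute (adjacent⇒distinct uv) uv) ⟩
    to (φ v T.∙ φ u)    ≡⟨ Enc.to-∙ (φ v) (φ u) ⟩
    embed v 𝔾.∙ embed u ∎

  embed-product-^ : ∀ u v k → (embed u 𝔾.∙ embed v) 𝔾.^ k ≡ to ((φ u T.∙ φ v) T.^ k)
  embed-product-^ u v k = begin
    (embed u 𝔾.∙ embed v) 𝔾.^ k ≡⟨ cong (𝔾._^ k) (Enc.to-∙ (φ u) (φ v)) ⟨
    to (φ u T.∙ φ v) 𝔾.^ k      ≡⟨ Enc.To.f-^ (φ u T.∙ φ v) k ⟨
    to ((φ u T.∙ φ v) T.^ k)    ∎

  edge⇒superAdj : ∀ {u v} → adj u v ≡ true →
    SuperEnhPowAdj (finite 𝔾) (embed u) (embed v) × SuperCommAdj (finite 𝔾) (embed u) (embed v)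
  edge⇒superAdj {u} {v} uv = power-of-product⇒superAdj 𝔾 (u≢v ∘ embed-injective) (embed-commute uv)
    (power-is-factor (ℕ.<-cmp (toℕ u) (toℕ v)))
    where
    u≢v : u ≢ v
    u≢v = adjacent⇒distinct uv
    power-is-factor : Tri (toℕ u ℕ.< toℕ v) (toℕ u ≡ toℕ v) (toℕ v ℕ.< toℕ u) →
      ∃[ k ] ((embed u 𝔾.∙ embed v) 𝔾.^ k ≡ embed u ⊎ (embed u 𝔾.∙ embed v) 𝔾.^ k ≡ embed v)
    power-is-factor (tri< u<v _ _) = order v , inj₁ (trans (embed-product-^ u v (order v))
      (cong to (φ-product-^ u≢v uv u<v)))
    power-is-factor (tri≈ _ u≡v _) = contradiction (toℕ-injective u≡v) u≢v
    power-is-factor (tri> _ _ v<u) = order u , inj₂ (trans (embed-product-^ u v (order u))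
      (cong to (trans (cong (T._^ order u) (φ-commute u≢v uv))
                      (φ-product-^ (u≢v ∘ sym) (trans (adj-sym v u) uv) v<u))))

  nonEdge⇒¬superAdj : ∀ {u v} → adj u v ≡ false →
    ¬ SuperEnhPowAdj (finite 𝔾) (embed u) (embed v) × ¬ SuperCommAdj (finite 𝔾) (embed u) (embed v)
  nonEdge⇒¬superAdj {u} {v} uv =
      (λ adjacent → proj₁ (apart (distinct adjacent)) adjacent)
    , (λ adjacent → proj₂ (apart (distinct adjacent)) adjacent)
    where
    distinct : ∀ {A} → embed u ≢ embed v × A → u ≢ v
    distinct (embed-u≢v , _) = embed-u≢v ∘ cong embed
    apart : u ≢ v → ¬ SuperEnhPowAdj (finite 𝔾) (embed u) (embed v) × ¬ SuperCommAdj (finite 𝔾) (embed u) (embed v)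
    apart u≢v = apart⇒¬superAdj 𝔾 (Enc.apart-transport (φ-apart u≢v uv))

≡true⇔ : ∀ {b : Bool} {A : Set} → (b ≡ true → A) → (b ≡ false → ¬ A) → (b ≡ true) ⇔ A
≡true⇔ {true}  ⇒A _  = mk⇔ ⇒A (λ _ → refl)
≡true⇔ {false} _  ⇒¬A = mk⇔ (λ ()) (λ a → ⊥-elim (⇒¬A refl a))

mainTheorem9 : (Γ : FiniteGraph) →
    (∃[ G ] IsoToInducedSubgraph Γ G (SuperEnhPowAdj G)) ×
    (∃[ G ] IsoToInducedSubgraph Γ G (SuperCommAdj G))
mainTheorem9 Γ =
    (finite 𝔾 , embed , embed-injective , λ u v → ≡true⇔ (proj₁ ∘ edge⇒superAdj) (proj₁ ∘ nonEdge⇒¬superAdj))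
  , (finite 𝔾 , embed , embed-injective , λ u v → ≡true⇔ (proj₂ ∘ edge⇒superAdj) (proj₂ ∘ nonEdge⇒¬superAdj))
  where open Construction Γ
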